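{- Let $G$ and $H$ be connected free graphs. If there exists an onto edge homomorphism from $G$ to $H$, then $\phi(G)\leq \phi(H)$.
   Context: All graphs are finite and simple. $N(v)$ denotes the (open) neighborhood of a vertex $v$. A homomorphism $f:G\to H$ is a map $f:V(G)\to V(H)$ such that $uv\in E(G)$ implies $f(u)f(v)\in E(H)$; it is an onto edge homomorphism if every edge of $H$ is of the form $f(u)f(v)$ for some edge $uv\in E(G)$. An independent set of a graph $G$ is a free independent set if it is contained in at least two distinct maximal independent sets of $G$ (equivalently, there is an edge $uv\in E(G)$ with $(N(u)\cup N(v))\cap F=\emptyset$). $G$ is a free graph if every vertex of $G$ lies in some free independent set. The free chromatic number $\phi(G)$ is the minimum positive integer $t$ such that $V(G)$ can be partitioned as $V_1\cup\cdots\cup V_t$ with each $V_i$ a free independent set of $G$; if $G$ is not free, $\phi(G)=\infty$. -}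

module Defs where

open import Data.Nat using (ℕ; _≤_)
open import Data.Fin using (Fin)
open import Data.Bool using (Bool; T)
open import Data.Product using (Σ; _×_; ∃; ∃-syntax)
open import Data.Fin.Subset using (Subset; _∈_; _∉_; _⊆_)
open import Relation.Nullary using (¬_)
open import Relation.Binary.PropositionalEquality using (_≡_; _≢_)

record Graph : Set where
  field
    n     : ℕ
    adj   : Fin n → Fin n → Bool
    sym   : ∀ u v → adj u v ≡ adj v u
    irrefl : ∀ v → adj v v ≡ Data.Bool.false

open Graph public

Vertex : Graph → Set
Vertex G = Fin (n G)

Edge : (G : Graph) → Vertex G → Vertex G → Set
Edge G u v = T (adj G u v)

data Reach (G : Graph) : Vertex G → Vertex G → Set where
  here : ∀ {v} → Reach G v v
  step : ∀ {u v w} → Edge G u v → Reach G v w → Reach G u w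

Connected : Graph → Set
Connected G = ∀ (u v : Vertex G) → Reach G u v

Independent : (G : Graph) → Subset (n G) → Set
Independent G I = ∀ u v → u ∈ I → v ∈ I → ¬ Edge G u v

MaximalIndependent : (G : Graph) → Subset (n G) → Set
MaximalIndependent G I =
  Independent G I × (∀ J → Independent G J → I ⊆ J → J ⊆ I)

FreeIndependent : (G : Graph) → Subset (n G) → Set
FreeIndependent G F =
  Independent G F ×
  Σ (Subset (n G)) λ I → Σ (Subset (n G)) λ J →
    MaximalIndependent G I × MaximalIndependent G J × I ≢ J × F ⊆ I × F ⊆ J

FreeGraph : Graph → Set
FreeGraph G = ∀ (v : Vertex G) → ∃[ F ] (FreeIndependent G F × v ∈ F)

FreePartition : (G : Graph) → ℕ → Set
FreePartition G t =
  Σ (Fin t → Subset (n G)) λ V →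
    (∀ i → FreeIndependent G (V i)) ×
    (∀ (v : Vertex G) → ∃[ i ] (v ∈ V i × (∀ j → v ∈ V j → j ≡ i)))

IsFreeChromaticNumber : (G : Graph) → ℕ → Set
IsFreeChromaticNumber G k =
  1 ≤ k × FreePartition G k × (∀ t → 1 ≤ t → FreePartition G t → k ≤ t)

IsHom : (G H : Graph) → (Vertex G → Vertex H) → Set
IsHom G H f = ∀ u v → Edge G u v → Edge H (f u) (f v)

IsOntoEdgeHom : (G H : Graph) → (Vertex G → Vertex H) → Set
IsOntoEdgeHom G H f =
  IsHom G H f ×
  (∀ x y → Edge H x y → ∃[ u ] ∃[ v ] (Edge G u v × f u ≡ x × f v ≡ y))

-- An independent set F is free exactly when some edge uv has N(u) ∪ N(v)
-- disjoint from F: two distinct maximal independent sets containing F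
-- yield such an edge (a vertex of one outside the other, together with
-- a neighbour in the other), and conversely F ∪ {u} and F ∪ {v} extend to
-- distinct maximal independent sets. Along an onto edge homomorphism
-- f : G → H, preimages of independent sets are independent and the edge
-- witnessing freeness in H lifts to one in G, so the preimage of a
-- partition of H into t free independent sets is such a partition of G.
module Submission where

open import Defs
open import Data.Nat using (ℕ; _≤_)
open import Data.Product using (Σ; _×_; _,_; proj₁; ∃-syntax)
open import Data.Sum using (_⊎_; inj₁; inj₂)
open import Data.Bool using (T; T?)
open import Data.Empty using (⊥; ⊥-elim)
open import Data.Fin using (Fin)
open import Data.Fin.Subset using (Subset; _∈_; _∉_; _⊆_; _∪_; ⁅_⁆)
open import Data.Fin.Subset.Properties
  using (_∈?_; _⊆?_; x∈⁅x⁆; x∈⁅y⁆⇒x≡y; x∈p∪q⁻; x∈p∪q⁺; p⊆p∪q; ⊆-antisym)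
open import Data.Fin.Properties using (any?)
open import Data.List using (List; []; _∷_; allFin)
import Data.List.Membership.Propositional as List
open import Data.List.Relation.Unary.Any using (here; there)
open import Data.List.Membership.Propositional.Properties using (∈-allFin)
open import Data.Vec using (tabulate; lookup)
open import Data.Vec.Properties using (lookup∘tabulate; []=⇒lookup; lookup⇒[]=)
open import Relation.Nullary using (¬_; Dec; yes; no)
open import Relation.Nullary.Decidable using (_×-dec_; ¬?)
open import Relation.Binary.PropositionalEquality using (_≡_; refl; trans; subst)
import Relation.Binary.PropositionalEquality as ≡

FreeEdge : (G : Graph) → Subset (n G) → Set
FreeEdge G F = ∃[ u ] ∃[ v ] (Edge G u v ×
  (∀ w → Edge G u w → w ∉ F) × (∀ w → Edge G v w → w ∉ F))

⊈⇒∃∉ : ∀ {m} {I J : Subset m} → ¬ (I ⊆ J) → ∃[ x ] (x ∈ I × x ∉ J)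
⊈⇒∃∉ {I = I} {J} I⊈J with any? (λ x → (x ∈? I) ×-dec ¬? (x ∈? J))
... | yes witness = witness
... | no none = ⊥-elim (I⊈J I⊆J)
  where
  I⊆J : I ⊆ J
  I⊆J {x} x∈I with x ∈? J
  ... | yes x∈J = x∈J
  ... | no x∉J = ⊥-elim (none (x , x∈I , x∉J))

module _ (G : Graph) where

  edge-sym : ∀ {u v} → Edge G u v → Edge G v u
  edge-sym {u} {v} = subst T (Graph.sym G u v)

  edge-irrefl : ∀ {v} → ¬ Edge G v v
  edge-irrefl {v} = subst T (irrefl G v)

  Dominated : Subset (n G) → Vertex G → Set
  Dominated I x = x ∈ I ⊎ ∃[ y ] (y ∈ I × Edge G x y)

  neighbourIn? : ∀ x S → Dec (∃[ y ] (y ∈ S × Edge G x y))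
  neighbourIn? x S = any? (λ y → (y ∈? S) ×-dec T? (adj G x y))

  independent-∪-⁅⁆ : ∀ {S x} → Independent G S →
    (∀ y → y ∈ S → ¬ Edge G x y) → Independent G (S ∪ ⁅ x ⁆)
  independent-∪-⁅⁆ {S} {x} indS x↛S u v u∈ v∈ e
    with x∈p∪q⁻ S ⁅ x ⁆ u∈ | x∈p∪q⁻ S ⁅ x ⁆ v∈
  ... | inj₁ u∈S | inj₁ v∈S = indS u v u∈S v∈S e
  ... | inj₁ u∈S | inj₂ v∈x rewrite x∈⁅y⁆⇒x≡y x v∈x = x↛S u u∈S (edge-sym e)
  ... | inj₂ u∈x | inj₁ v∈S rewrite x∈⁅y⁆⇒x≡y x u∈x = x↛S v v∈S e
  ... | inj₂ u∈x | inj₂ v∈x rewrite x∈⁅y⁆⇒x≡y x u∈x | x∈⁅y⁆⇒x≡y x v∈x =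
    edge-irrefl e

  x∈S∪⁅x⁆ : ∀ {S : Subset (n G)} x → x ∈ S ∪ ⁅ x ⁆
  x∈S∪⁅x⁆ x = x∈p∪q⁺ (inj₂ (x∈⁅x⁆ x))

  maximal⇒dominated : ∀ {J} → MaximalIndependent G J → ∀ x → Dominated J x
  maximal⇒dominated {J} (indJ , maxJ) x with neighbourIn? x J
  ... | yes nb = inj₂ nb
  ... | no ¬nb = inj₁ (maxJ (J ∪ ⁅ x ⁆)
    (independent-∪-⁅⁆ indJ (λ y y∈J e → ¬nb (y , y∈J , e))) (p⊆p∪q ⁅ x ⁆) (x∈S∪⁅x⁆ x))

  dominated⇒maximal : ∀ {I} → Independent G I → (∀ x → Dominated I x) →
    MaximalIndependent G I
  dominated⇒maximal {I} indI dom = indI , grow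
    where
    grow : ∀ J → Independent G J → I ⊆ J → J ⊆ I
    grow J indJ I⊆J {x} x∈J with dom x
    ... | inj₁ x∈I = x∈I
    ... | inj₂ (y , y∈I , e) = ⊥-elim (indJ x y x∈J (I⊆J y∈I) e)

  greedyStep : Vertex G → Subset (n G) → Subset (n G)
  greedyStep x S with neighbourIn? x S
  ... | yes _ = S
  ... | no _ = S ∪ ⁅ x ⁆

  greedyStep-⊇ : ∀ x S → S ⊆ greedyStep x S
  greedyStep-⊇ x S with neighbourIn? x S
  ... | yes _ = λ p → p
  ... | no _ = p⊆p∪q _

  greedyStep-independent : ∀ x S → Independent G S → Independent G (greedyStep x S)
  greedyStep-independent x S indS with neighbourIn? x S
  ... | yes _ = indS
  ... | no ¬nb = independent-∪-⁅⁆ indS (λ y y∈S e → ¬nb (y , y∈S , e))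

  greedyStep-dominated : ∀ x S → Dominated (greedyStep x S) x
  greedyStep-dominated x S with neighbourIn? x S
  ... | yes nb = inj₂ nb
  ... | no _ = inj₁ (x∈S∪⁅x⁆ x)

  dominated-mono : ∀ {S T x} → S ⊆ T → Dominated S x → Dominated T x
  dominated-mono S⊆T (inj₁ x∈S) = inj₁ (S⊆T x∈S)
  dominated-mono S⊆T (inj₂ (y , y∈S , e)) = inj₂ (y , S⊆T y∈S , e)

  greedy : List (Vertex G) → Subset (n G) → Subset (n G)
  greedy [] S = S
  greedy (x ∷ xs) S = greedy xs (greedyStep x S)

  greedy-⊇ : ∀ xs S → S ⊆ greedy xs S
  greedy-⊇ [] S p = p
  greedy-⊇ (x ∷ xs) S p = greedy-⊇ xs _ (greedyStep-⊇ x S p)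

  greedy-independent : ∀ xs S → Independent G S → Independent G (greedy xs S)
  greedy-independent [] S indS = indS
  greedy-independent (x ∷ xs) S indS =
    greedy-independent xs _ (greedyStep-independent x S indS)

  greedy-dominated : ∀ xs S x → x List.∈ xs → Dominated (greedy xs S) x
  greedy-dominated (x ∷ xs) S .x (here refl) =
    dominated-mono (greedy-⊇ xs _) (greedyStep-dominated x S)
  greedy-dominated (_ ∷ xs) S x (there x∈xs) = greedy-dominated xs _ x x∈xs

  extendToMaximal : ∀ {S} → Independent G S →
    Σ (Subset (n G)) λ I → MaximalIndependent G I × S ⊆ I
  extendToMaximal {S} indS =
    I , dominated⇒maximal (greedy-independent vs S indS)
          (λ x → greedy-dominated vs S x (∈-allFin x)) ,
    greedy-⊇ vs S
    where
    vs : List (Vertex G)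
    vs = allFin (n G)
    I : Subset (n G)
    I = greedy vs S

  freeEdge⇒freeIndependent : ∀ {F} → Independent G F → FreeEdge G F →
    FreeIndependent G F
  freeEdge⇒freeIndependent {F} indF (u , v , uv , u↛F , v↛F)
    with extendToMaximal (independent-∪-⁅⁆ {F} {u} indF (λ w w∈F e → u↛F w e w∈F))
       | extendToMaximal (independent-∪-⁅⁆ {F} {v} indF (λ w w∈F e → v↛F w e w∈F))
  ... | I , maxI , Fu⊆I | J , maxJ , Fv⊆J =
    indF , I , J , maxI , maxJ , I≢J ,
    (λ p → Fu⊆I (p⊆p∪q _ p)) , (λ p → Fv⊆J (p⊆p∪q _ p))
    where
    I≢J : I ≡ J → ⊥
    I≢J refl = proj₁ maxI u v (Fu⊆I (x∈S∪⁅x⁆ u)) (Fv⊆J (x∈S∪⁅x⁆ v)) uv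

  -- A vertex x of I outside the maximal set J has a neighbour y ∈ J; then
  -- N(x) avoids F ⊆ I and N(y) avoids F ⊆ J.
  freeEdge-from-⊈ : ∀ {F I J} → Independent G I → MaximalIndependent G J →
    F ⊆ I → F ⊆ J → ¬ (I ⊆ J) → FreeEdge G F
  freeEdge-from-⊈ indI maxJ F⊆I F⊆J I⊈J with ⊈⇒∃∉ I⊈J
  ... | x , x∈I , x∉J with maximal⇒dominated maxJ x
  ...   | inj₁ x∈J = ⊥-elim (x∉J x∈J)
  ...   | inj₂ (y , y∈J , xy) =
    x , y , xy , (λ w xw w∈F → indI x w x∈I (F⊆I w∈F) xw)
               , (λ w yw w∈F → proj₁ maxJ y w y∈J (F⊆J w∈F) yw)

  freeIndependent⇒freeEdge : ∀ {F} → FreeIndependent G F → FreeEdge G F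
  freeIndependent⇒freeEdge (_ , I , J , maxI , maxJ , I≢J , F⊆I , F⊆J)
    with I ⊆? J | J ⊆? I
  ... | yes I⊆J | yes J⊆I = ⊥-elim (I≢J (⊆-antisym I⊆J J⊆I))
  ... | no I⊈J | _ = freeEdge-from-⊈ (proj₁ maxI) maxJ F⊆I F⊆J I⊈J
  ... | yes _ | no J⊈I = freeEdge-from-⊈ (proj₁ maxJ) maxI F⊆J F⊆I J⊈I

preimage : ∀ {m k} → (Fin m → Fin k) → Subset k → Subset m
preimage f W = tabulate (λ u → lookup W (f u))

∈-preimage⁺ : ∀ {m k} {f : Fin m → Fin k} {W u} → f u ∈ W → u ∈ preimage f W
∈-preimage⁺ {f = f} {W} {u} fu∈W = lookup⇒[]= u (preimage f W)
  (trans (lookup∘tabulate (λ u → lookup W (f u)) u) ([]=⇒lookup fu∈W))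

∈-preimage⁻ : ∀ {m k} {f : Fin m → Fin k} {W u} → u ∈ preimage f W → f u ∈ W
∈-preimage⁻ {f = f} {W} {u} u∈ = lookup⇒[]= (f u) W
  (trans (≡.sym (lookup∘tabulate (λ u → lookup W (f u)) u)) ([]=⇒lookup u∈))

module _ (G H : Graph) (f : Vertex G → Vertex H) where

  preimage-independent : IsHom G H f → ∀ {W} → Independent H W →
    Independent G (preimage f W)
  preimage-independent hom indW u v u∈ v∈ uv =
    indW (f u) (f v) (∈-preimage⁻ u∈) (∈-preimage⁻ v∈) (hom u v uv)

  preimage-freeEdge : IsOntoEdgeHom G H f → ∀ {W} → FreeEdge H W →
    FreeEdge G (preimage f W)
  preimage-freeEdge (hom , onto) (x , y , xy , x↛W , y↛W) with onto x y xy
  ... | u , v , uv , refl , refl =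
    u , v , uv , (λ w uw w∈ → x↛W (f w) (hom u w uw) (∈-preimage⁻ w∈))
               , (λ w vw w∈ → y↛W (f w) (hom v w vw) (∈-preimage⁻ w∈))

  preimage-freeIndependent : IsOntoEdgeHom G H f → ∀ {W} →
    FreeIndependent H W → FreeIndependent G (preimage f W)
  preimage-freeIndependent ontoHom@(hom , _) freeW =
    freeEdge⇒freeIndependent G (preimage-independent hom (proj₁ freeW))
      (preimage-freeEdge ontoHom (freeIndependent⇒freeEdge H freeW))

  preimage-freePartition : IsOntoEdgeHom G H f → ∀ {t} →
    FreePartition H t → FreePartition G t
  preimage-freePartition ontoHom (W , freeW , partW) =
    (λ i → preimage f (W i)) ,
    (λ i → preimage-freeIndependent ontoHom (freeW i)) ,
    λ v → let (i , fv∈Wi , unique) = partW (f v)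
          in i , ∈-preimage⁺ fv∈Wi , λ j v∈ → unique j (∈-preimage⁻ v∈)

mainTheorem1 : (G H : Graph) → Connected G → Connected H →
    FreeGraph G → FreeGraph H →
    Σ (Vertex G → Vertex H) (IsOntoEdgeHom G H) →
    (φG φH : ℕ) → IsFreeChromaticNumber G φG → IsFreeChromaticNumber H φH →
    φG ≤ φH
mainTheorem1 G H _ _ _ _ (f , ontoHom) φG φH (_ , _ , φG-minimal) (1≤φH , partH , _) =
  φG-minimal φH 1≤φH (preimage-freePartition G H f ontoHom partH)
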